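{- Let $F$ be a graph of diameter $2$ with $n=|V(F)|$ and minimum degree $t=\delta(F)$, and let $l>n$ be an integer. Let $F_{2l}$ be the graph with vertex set $\{1,\dots,2l\}$ whose edges are all pairs $(i,j)$ with $i\ne j$, $i,j\in\{1,\dots,2l-1\}$, $|i-j|\le l-1$, together with $(1,2l),\dots,(t,2l)$. Let $f_{2l}$ be the $F$-degree of the vertex $2l$ in $F_{2l}$. Then $f_{2l}\le n!\,C_{l-1}^{n-t-1}$.
   Context: All graphs are finite, simple and undirected. For graphs $F$ and $G$ and a vertex $v$ of $G$, the $F$-degree of $v$ in $G$ is the number of subgraphs of $G$ (not necessarily induced) that are isomorphic to $F$ and contain $v$. $\delta(F)$ is the minimum vertex degree of $F$. $C_m^k=\frac{m!}{k!(m-k)!}$ for integers $m\ge k\ge0$ and $C_m^k=0$ otherwise. -}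

module Defs where

open import Data.Bool using (Bool; true; false; _∧_; _∨_; not; T)
open import Data.Nat using (ℕ; zero; suc; _+_; _*_; _∸_; _≤_; _<_; _≤ᵇ_; _<ᵇ_; _≡ᵇ_; ∣_-_∣)
open import Data.Fin using (Fin; toℕ)
open import Data.Fin.Properties using (_≟_)
open import Data.Vec using (Vec; []; _∷_; lookup)
open import Data.List using (List; []; _∷_; map; concatMap; length; filterᵇ; allFin)
open import Data.Bool.ListAction using (all; any)
open import Data.Product using (_×_; _,_; ∃; Σ)
open import Relation.Binary.PropositionalEquality using (_≡_; _≢_)
open import Relation.Nullary.Decidable using (⌊_⌋)

record Graph (n : ℕ) : Set where
  field
    adj   : Fin n → Fin n → Bool
    sym   : ∀ u v → adj u v ≡ adj v u
    irrfl : ∀ v → adj v v ≡ false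
open Graph public

allᶠ : ∀ {k} → (Fin k → Bool) → Bool
allᶠ {k} p = all p (allFin k)

anyᶠ : ∀ {k} → (Fin k → Bool) → Bool
anyᶠ {k} p = any p (allFin k)

_==_ : ∀ {k} → Fin k → Fin k → Bool
i == j = ⌊ i ≟ j ⌋

_⇔ᵇ_ : Bool → Bool → Bool
true ⇔ᵇ b = b
false ⇔ᵇ b = not b

deg : ∀ {n} → Graph n → Fin n → ℕ
deg G v = length (filterᵇ (adj G v) (allFin _))

IsMinDegree : ∀ {n} → Graph n → ℕ → Set
IsMinDegree F t = (∀ v → t ≤ deg F v) × ∃ λ v → deg F v ≡ t

-- Diameter exactly 2: every two distinct vertices are adjacent or have a
-- common neighbour (so distance ≤ 2 and the graph is connected), and some
-- two distinct vertices are non-adjacent (so some distance equals 2).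
HasDiameter2 : ∀ {n} → Graph n → Set
HasDiameter2 F =
  (∀ u v → u ≢ v → T (adj F u v) ⊎' ∃ λ w → T (adj F u w ∧ adj F w v))
  × ∃ λ u → ∃ λ v → u ≢ v × adj F u v ≡ false
  where
  open import Data.Sum renaming (_⊎_ to _⊎'_)

allVecs : ∀ {A : Set} → List A → (k : ℕ) → List (Vec A k)
allVecs xs zero = [] ∷ []
allVecs xs (suc k) = concatMap (λ x → map (x ∷_) (allVecs xs k)) xs

bools : List Bool
bools = true ∷ false ∷ []

-- A subgraph of a graph on Fin m is represented by its vertex set S
-- (a Boolean vector) and its edge set E (a Boolean adjacency matrix).
SubG : ℕ → Set
SubG m = Vec Bool m × Vec (Vec Bool m) m

allSubG : (m : ℕ) → List (SubG m)
allSubG m = concatMap (λ S → map (S ,_) (allVecs (allVecs bools m) m)) (allVecs bools m)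

edge : ∀ {m} → Vec (Vec Bool m) m → Fin m → Fin m → Bool
edge E i j = lookup (lookup E i) j

isSubgraph : ∀ {m} → (Fin m → Fin m → Bool) → SubG m → Bool
isSubgraph G (S , E) =
  allᶠ λ i → allᶠ λ j → not (edge E i j) ∨ (G i j ∧ lookup S i ∧ lookup S j)

isIsoOnto : ∀ {n m} → Graph n → SubG m → Vec (Fin m) n → Bool
isIsoOnto F (S , E) σ =
  (allᶠ λ a → allᶠ λ b → (lookup σ a == lookup σ b) ⇔ᵇ (a == b))
  ∧ (allᶠ λ i → lookup S i ⇔ᵇ (anyᶠ λ a → lookup σ a == i))
  ∧ (allᶠ λ a → allᶠ λ b → adj F a b ⇔ᵇ edge E (lookup σ a) (lookup σ b))

isCopyAt : ∀ {n m} → Graph n → (Fin m → Fin m → Bool) → Fin m → SubG m → Bool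
isCopyAt {n} {m} F G v H@(S , E) =
  lookup S v ∧ isSubgraph G H ∧ any (isIsoOnto F H) (allVecs (allFin m) n)

Fdeg : ∀ {n m} → Graph n → (Fin m → Fin m → Bool) → Fin m → ℕ
Fdeg {n} {m} F G v = length (filterᵇ (isCopyAt F G v) (allSubG m))

-- The graph F_{2l} with parameter t, vertices 0-indexed: vertex k ↦ k+1.
-- Edges: i ≠ j, i, j ≤ 2l-2, |i-j| ≤ l-1; plus (k , 2l-1) for k < t.
FL-adj : (l t : ℕ) → Fin (2 * l) → Fin (2 * l) → Bool
FL-adj l t x y =
  (not (i ≡ᵇ j) ∧ (i <ᵇ 2 * l ∸ 1) ∧ (j <ᵇ 2 * l ∸ 1) ∧ (∣ i - j ∣ ≤ᵇ l ∸ 1))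
  ∨ ((j ≡ᵇ 2 * l ∸ 1) ∧ (i <ᵇ t))
  ∨ ((i ≡ᵇ 2 * l ∸ 1) ∧ (j <ᵇ t))
  where
  i = toℕ x
  j = toℕ y

{-# OPTIONS --safe #-}
module Submission where

-- A copy of F through the last vertex z is determined by its embedding σ, which we read
-- as a duplicate-free list of n vertices of F_{2l}. The preimage of z has at least t
-- neighbours, and σ maps them injectively into the t neighbours 1, …, t of z, so the list
-- contains z and all of 1, …, t. Since F has diameter 2, each remaining vertex of the copy
-- is adjacent to the image of a neighbour of that preimage, i.e. to one of 1, …, t, hence is
-- one of the l - 1 vertices t + 1, …, t + l - 1. There are n! · C(l - 1, n - t - 1) such lists.

open import Data.Bool using (Bool; true; false; _∧_; _∨_; not; T)
open import Data.Fin as Fin using (Fin; toℕ)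
open import Data.Fin.Properties using (toℕ-injective) renaming (_≟_ to _≟ᶠ_)
open import Data.List as List
  using (List; []; _∷_; _++_; map; concatMap; cartesianProductWith; length; filterᵇ; allFin; upTo; applyUpTo)
open import Data.List.Properties
  using ( length-++; length-map; length-tabulate; length-upTo; length-applyUpTo; length-removeAt′
        ; length-filter; ∷-injective)
open import Data.List.Membership.Propositional using (_∈_; _∉_; _─_; lose)
open import Data.List.Membership.Propositional.Properties
open import Data.List.Relation.Binary.Disjoint.Propositional using (Disjoint)
open import Data.List.Relation.Binary.Subset.Propositional using (_⊆_)
import Data.List.Relation.Unary.All as All
open import Data.List.Relation.Unary.All.Properties using (─⁺; all⁺)
open import Data.List.Relation.Unary.Any as Any using (here; there; index)
open import Data.List.Relation.Unary.Any.Properties using (any⁻)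
open import Data.List.Relation.Unary.AllPairs using ([]; _∷_)
open import Data.List.Relation.Unary.Unique.Propositional using (Unique)
open import Data.List.Relation.Unary.Unique.Propositional.Properties
  using (cartesianProductWith⁺; filter⁺; allFin⁺; upTo⁺; tabulate⁺)
open import Data.Nat
open import Data.Nat.Properties
open import Algebra.Properties.CommutativeSemigroup *-commutativeSemigroup using (x∙yz≈y∙xz)
open import Data.Nat.Combinatorics using (_C_; nC1≡n; nCk+nC[k+1]≡[n+1]C[k+1])
open import Data.Nat.Tactic.RingSolver using (solve-∀)
open import Data.Product using (_×_; _,_; ∃; proj₁; proj₂; map₂; uncurry)
open import Data.Sum using (_⊎_; inj₁; inj₂)
open import Data.Vec as Vec using (Vec; lookup)
open import Data.Vec.Properties using (tabulate∘lookup; tabulate-cong)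
open import Function using (_∘_; id)
open import Relation.Binary.Definitions using (DecidableEquality; tri<; tri≈; tri>)
open import Relation.Binary.PropositionalEquality
  using (_≡_; _≢_; refl; sym; trans; cong; cong₂; subst; module ≡-Reasoning)
open import Relation.Nullary using (¬_; yes; no; contradiction)
open import Relation.Nullary.Decidable using (T?; toWitness; fromWitness)

open import Defs hiding (sym)

module _ {A : Set} where

  ∈-─⁺ : ∀ {x y} {xs : List A} (p : x ∈ xs) → y ∈ xs → y ≢ x → y ∈ xs ─ p
  ∈-─⁺ (here refl) (here refl) y≢x = contradiction refl y≢x
  ∈-─⁺ (here refl) (there q)   _   = q
  ∈-─⁺ (there p)   (here refl) _   = here refl
  ∈-─⁺ (there p)   (there q)   y≢x = there (∈-─⁺ p q y≢x)

  ∈-─⁻ : ∀ {x y} {xs : List A} (p : x ∈ xs) → y ∈ xs ─ p → y ∈ xs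
  ∈-─⁻ (here _)  q         = there q
  ∈-─⁻ (there p) (here e)  = here e
  ∈-─⁻ (there p) (there q) = there (∈-─⁻ p q)

  length-─ : ∀ {x} {xs : List A} (p : x ∈ xs) → length xs ≡ suc (length (xs ─ p))
  length-─ {xs = xs} p = length-removeAt′ xs (index p)

  Unique-─ : ∀ {x} {xs : List A} (p : x ∈ xs) → Unique xs → Unique (xs ─ p)
  Unique-─ (here _)  (_  ∷ u) = u
  Unique-─ (there p) (x∉ ∷ u) = ─⁺ p x∉ ∷ Unique-─ p u

  Unique⇒∉─ : ∀ {x} {xs : List A} (p : x ∈ xs) → Unique xs → x ∉ xs ─ p
  Unique⇒∉─ (here refl) (x∉ ∷ _) q           = All.lookup x∉ q refl
  Unique⇒∉─ (there p)   (y∉ ∷ _) (here refl) = All.lookup y∉ p refl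
  Unique⇒∉─ (there p)   (_  ∷ u) (there q)   = Unique⇒∉─ p u q

module _ {A B : Set} (R : A → B → Set) (R-injective : ∀ {x x′ y} → R x y → R x′ y → x ≡ x′) where

  injection⇒length≤ : ∀ {xs} → Unique xs → (ys : List B) →
                      (∀ {x} → x ∈ xs → ∃ λ y → y ∈ ys × R x y) → length xs ≤ length ys
  injection⇒length≤ []                  ys into = z≤n
  injection⇒length≤ {x ∷ xs} (x∉ ∷ u) ys into with y , y∈ys , Rxy ← into (here refl) =
    ≤-trans (s≤s (injection⇒length≤ u (ys ─ y∈ys) into′)) (≤-reflexive (sym (length-─ y∈ys)))
    where
    into′ : ∀ {x′} → x′ ∈ xs → ∃ λ y′ → y′ ∈ ys ─ y∈ys × R x′ y′
    into′ q with y′ , y′∈ys , Rx′y′ ← into (there q) =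
      y′ , ∈-─⁺ y∈ys y′∈ys (λ { refl → All.lookup x∉ q (R-injective Rxy Rx′y′) }) , Rx′y′

module _ {A B : Set} (_≟_ : DecidableEquality B) (f : A → B)
         (f-injective : ∀ {x x′} → f x ≡ f x′ → x ≡ x′) where

  injection-onto : ∀ {xs ys} → Unique xs → (∀ {x} → x ∈ xs → f x ∈ ys) → length ys ≤ length xs →
                   ∀ {y} → y ∈ ys → ∃ λ x → f x ≡ y
  injection-onto {xs} {ys} u into ys≤xs {y} y∈ys with Any.any? (λ x → f x ≟ y) xs
  ... | yes hit  = Any.satisfied hit
  ... | no  miss = contradiction (≤-<-trans xs≤ys─y (<-≤-trans ys─y<ys ys≤xs)) (<-irrefl refl)
    where
    xs≤ys─y : length xs ≤ length (ys ─ y∈ys)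
    xs≤ys─y = injection⇒length≤ (λ x y′ → f x ≡ y′) (λ e e′ → f-injective (trans e (sym e′)))
                u (ys ─ y∈ys)
                (λ q → f _ , ∈-─⁺ y∈ys (into q) (miss ∘ lose q) , refl)
    ys─y<ys : length (ys ─ y∈ys) < length ys
    ys─y<ys = ≤-reflexive (sym (length-─ y∈ys))

length-concatMap-const : ∀ {A B : Set} (g : A → List B) c (xs : List A) →
                         (∀ {x} → x ∈ xs → length (g x) ≡ c) → length (concatMap g xs) ≡ length xs * c
length-concatMap-const g c []       _     = refl
length-concatMap-const g c (x ∷ xs) const =
  trans (length-++ (g x)) (cong₂ _+_ (const (here refl)) (length-concatMap-const g c xs (const ∘ there)))

module _ {A : Set} where

  picks : List A → List (A × List A)
  picks []       = []
  picks (x ∷ xs) = (x , xs) ∷ map (map₂ (x ∷_)) (picks xs)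

  ∈-picks : ∀ {x} {xs : List A} (p : x ∈ xs) → (x , xs ─ p) ∈ picks xs
  ∈-picks (here refl)            = here refl
  ∈-picks {xs = y ∷ _} (there p) = there (∈-map⁺ (map₂ (y ∷_)) (∈-picks p))

  length-∈-picks : ∀ {x r} (xs : List A) → (x , r) ∈ picks xs → length xs ≡ suc (length r)
  length-∈-picks (_ ∷ xs) (here refl) = refl
  length-∈-picks (y ∷ xs) (there q) with _ , q′ , refl ← ∈-map⁻ (map₂ (y ∷_)) q =
    cong suc (length-∈-picks xs q′)

  length-picks : (xs : List A) → length (picks xs) ≡ length xs
  length-picks []       = refl
  length-picks (x ∷ xs) = cong suc (trans (length-map (map₂ (x ∷_)) (picks xs)) (length-picks xs))

  -- For duplicate-free R disjoint from O: the duplicate-free lists of length n that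
  -- contain every element of R, their other elements being taken from O.
  arrangements : ℕ → List A → List A → List (List A)
  arrangements zero    []      O = [] ∷ []
  arrangements zero    (_ ∷ _) O = []
  arrangements (suc n) R       O =
    concatMap (uncurry λ x R′ → map (x ∷_) (arrangements n R′ O)) (picks R) ++
    concatMap (uncurry λ x O′ → map (x ∷_) (arrangements n R O′)) (picks O)

  ∷-∈-arrangements-required : ∀ {n x w R O} (p : x ∈ R) →
                              w ∈ arrangements n (R ─ p) O → x ∷ w ∈ arrangements (suc n) R O
  ∷-∈-arrangements-required {x = x} p w∈ =
    ∈-++⁺ˡ (∈-concatMap⁺ _ (lose (∈-picks p) (∈-map⁺ (x ∷_) w∈)))

  ∷-∈-arrangements-optional : ∀ {n x w R O} (p : x ∈ O) →
                              w ∈ arrangements n R (O ─ p) → x ∷ w ∈ arrangements (suc n) R O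
  ∷-∈-arrangements-optional {x = x} {R = R} p w∈ =
    ∈-++⁺ʳ (concatMap _ (picks R)) (∈-concatMap⁺ _ (lose (∈-picks p) (∈-map⁺ (x ∷_) w∈)))

  ∈-arrangements : ∀ {R O} → Unique R → Disjoint R O → ∀ {w} → Unique w → R ⊆ w →
                   (∀ {x} → x ∈ w → x ∈ R ⊎ x ∈ O) → w ∈ arrangements (length w) R O
  ∈-arrangements {[]}    _ _ {[]} _ _    _ = here refl
  ∈-arrangements {_ ∷ _} _ _ {[]} _ R⊆w _ with () ← R⊆w (here refl)
  ∈-arrangements {R} {O} uR R#O {x ∷ w} (x∉w ∷ uw) R⊆w within with within (here refl)
  ... | inj₁ x∈R = ∷-∈-arrangements-required {n = length w} x∈R
    (∈-arrangements (Unique-─ x∈R uR) (λ (r∈ , r∈O) → R#O (∈-─⁻ x∈R r∈ , r∈O))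
                    uw R─x⊆w within′)
    where
    R─x⊆w : R ─ x∈R ⊆ w
    R─x⊆w r∈ with R⊆w (∈-─⁻ x∈R r∈)
    ... | here refl = contradiction r∈ (Unique⇒∉─ x∈R uR)
    ... | there r∈w = r∈w
    within′ : ∀ {y} → y ∈ w → y ∈ R ─ x∈R ⊎ y ∈ O
    within′ y∈w with within (there y∈w)
    ... | inj₁ y∈R = inj₁ (∈-─⁺ x∈R y∈R λ { refl → All.lookup x∉w y∈w refl })
    ... | inj₂ y∈O = inj₂ y∈O
  ... | inj₂ x∈O = ∷-∈-arrangements-optional {n = length w} x∈O
    (∈-arrangements uR (λ (r∈R , r∈) → R#O (r∈R , ∈-─⁻ x∈O r∈)) uw R⊆w′ within′)
    where
    R⊆w′ : R ⊆ w
    R⊆w′ r∈R with R⊆w r∈R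
    ... | here refl = contradiction (r∈R , x∈O) R#O
    ... | there r∈w = r∈w
    within′ : ∀ {y} → y ∈ w → y ∈ R ⊎ y ∈ O ─ x∈O
    within′ y∈w with within (there y∈w)
    ... | inj₁ y∈R = inj₁ y∈R
    ... | inj₂ y∈O = inj₂ (∈-─⁺ x∈O y∈O λ { refl → All.lookup x∉w y∈w refl })

#arrangements : ℕ → ℕ → ℕ → ℕ
#arrangements zero    zero    b = 1
#arrangements zero    (suc a) b = 0
#arrangements (suc n) a       b = a * #arrangements n (pred a) b + b * #arrangements n a (pred b)

length-arrangements : ∀ {A : Set} n (R O : List A) →
                      length (arrangements n R O) ≡ #arrangements n (length R) (length O)
length-arrangements zero    []      O = refl
length-arrangements zero    (_ ∷ _) O = refl
length-arrangements (suc n) R       O = begin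
  length (arrangements (suc n) R O)
    ≡⟨ length-++ (concatMap _ (picks R)) ⟩
  length (concatMap _ (picks R)) + length (concatMap _ (picks O))
    ≡⟨ cong₂ _+_ (length-concatMap-const _ _ (picks R) shrink-R)
                 (length-concatMap-const _ _ (picks O) shrink-O) ⟩
  length (picks R) * _ + length (picks O) * _
    ≡⟨ cong₂ (λ a b → a * #arrangements n (pred (length R)) (length O)
                    + b * #arrangements n (length R) (pred (length O)))
             (length-picks R) (length-picks O) ⟩
  #arrangements (suc n) (length R) (length O) ∎
  where
  open ≡-Reasoning
  shrink-R : ∀ {p} → p ∈ picks R →
             length (map (proj₁ p ∷_) (arrangements n (proj₂ p) O)) ≡ #arrangements n (pred (length R)) (length O)
  shrink-R {x , R′} q rewrite length-∈-picks R q =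
    trans (length-map (List._∷_ x) (arrangements n R′ O)) (length-arrangements n R′ O)
  shrink-O : ∀ {p} → p ∈ picks O →
             length (map (proj₁ p ∷_) (arrangements n R (proj₂ p))) ≡ #arrangements n (length R) (pred (length O))
  shrink-O {x , O′} q rewrite length-∈-picks O q =
    trans (length-map (List._∷_ x) (arrangements n R O′)) (length-arrangements n R O′)

#arrangements-zero : ∀ {n a} b → n < a → #arrangements n a b ≡ 0
#arrangements-zero {zero}  {suc a} b _         = refl
#arrangements-zero {suc n} {suc a} b (s<s n<a) = begin
  suc a * #arrangements n a b + b * #arrangements n (suc a) (pred b)
    ≡⟨ cong₂ (λ x y → suc a * x + b * y)
             (#arrangements-zero b n<a) (#arrangements-zero (pred b) (m<n⇒m<1+n n<a)) ⟩
  suc a * 0 + b * 0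
    ≡⟨ cong₂ _+_ (*-zeroʳ (suc a)) (*-zeroʳ b) ⟩
  0 ∎
  where open ≡-Reasoning

[k+1]*[n+1]C[k+1]≡[n+1]*nCk : ∀ n k → suc k * (suc n C suc k) ≡ suc n * (n C k)
[k+1]*[n+1]C[k+1]≡[n+1]*nCk n       zero    =
  trans (+-identityʳ _) (trans (nC1≡n (suc n)) (sym (*-identityʳ (suc n))))
[k+1]*[n+1]C[k+1]≡[n+1]*nCk zero    (suc k) = *-zeroʳ (suc (suc k))
[k+1]*[n+1]C[k+1]≡[n+1]*nCk (suc n) (suc k) = begin
  suc (suc k) * (suc (suc n) C suc (suc k))   ≡⟨ cong (suc (suc k) *_) (nCk+nC[k+1]≡[n+1]C[k+1] (suc n) (suc k)) ⟨
  suc (suc k) * (A + B)                       ≡⟨ distrib k A B ⟩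
  A + (suc k * A + suc (suc k) * B)           ≡⟨ cong₂ (λ x y → A + (x + y)) ([k+1]*[n+1]C[k+1]≡[n+1]*nCk n k)
                                                                           ([k+1]*[n+1]C[k+1]≡[n+1]*nCk n (suc k)) ⟩
  A + (suc n * (n C k) + suc n * (n C suc k)) ≡⟨ cong (A +_) (*-distribˡ-+ (suc n) (n C k) _) ⟨
  A + suc n * (n C k + n C suc k)             ≡⟨ cong (λ x → A + suc n * x) (nCk+nC[k+1]≡[n+1]C[k+1] n k) ⟩
  suc (suc n) * (suc n C suc k)               ∎
  where
  open ≡-Reasoning
  A B : ℕ
  A = suc n C suc k
  B = suc n C suc (suc k)
  distrib : ∀ k A B → suc (suc k) * (A + B) ≡ A + (suc k * A + suc (suc k) * B)
  distrib = solve-∀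

n*[n∸1]Ck≡[k+1]*nC[k+1] : ∀ n k → n * (pred n C k) ≡ suc k * (n C suc k)
n*[n∸1]Ck≡[k+1]*nC[k+1] zero    k = sym (*-zeroʳ (suc k))
n*[n∸1]Ck≡[k+1]*nC[k+1] (suc n) k = sym ([k+1]*[n+1]C[k+1]≡[n+1]*nCk n k)

#arrangements≤ : ∀ n a b → #arrangements n a b ≤ n ! * (b C (n ∸ a))
#arrangements≤ zero    zero    b = ≤-refl
#arrangements≤ zero    (suc a) b = z≤n
#arrangements≤ (suc n) zero    b = begin
  b * #arrangements n 0 (pred b)  ≤⟨ *-monoʳ-≤ b (#arrangements≤ n 0 (pred b)) ⟩
  b * (n ! * (pred b C n))        ≡⟨ x∙yz≈y∙xz b (n !) _ ⟩
  n ! * (b * (pred b C n))        ≡⟨ cong (n ! *_) (n*[n∸1]Ck≡[k+1]*nC[k+1] b n) ⟩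
  n ! * (suc n * (b C suc n))     ≡⟨ x∙yz≈y∙xz (n !) (suc n) _ ⟩
  suc n * (n ! * (b C suc n))     ≡⟨ *-assoc (suc n) (n !) _ ⟨
  suc n ! * (b C suc n)           ∎
  where open ≤-Reasoning
#arrangements≤ (suc n) (suc a) b with <-cmp a n
... | tri> _ _ n<a  = ≤-trans (≤-reflexive (#arrangements-zero b (s<s n<a))) z≤n
... | tri≈ _ refl _ = begin
  suc a * #arrangements a a b + b * #arrangements a (suc a) (pred b)
    ≡⟨ cong (λ x → suc a * #arrangements a a b + b * x) (#arrangements-zero (pred b) (n<1+n a)) ⟩
  suc a * #arrangements a a b + b * 0   ≡⟨ cong (suc a * #arrangements a a b +_) (*-zeroʳ b) ⟩
  suc a * #arrangements a a b + 0       ≡⟨ +-identityʳ _ ⟩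
  suc a * #arrangements a a b           ≤⟨ *-monoʳ-≤ (suc a) (#arrangements≤ a a b) ⟩
  suc a * (a ! * (b C (a ∸ a)))         ≡⟨ *-assoc (suc a) (a !) _ ⟨
  suc a ! * (b C (a ∸ a))               ∎
  where open ≤-Reasoning
... | tri< a<n _ _  = begin
  suc a * #arrangements n a b + b * #arrangements n (suc a) (pred b)
    ≤⟨ +-mono-≤ (*-monoʳ-≤ (suc a) (#arrangements≤ n a b))
                (*-monoʳ-≤ b (#arrangements≤ n (suc a) (pred b))) ⟩
  suc a * (n ! * (b C (n ∸ a))) + b * (n ! * (pred b C k))
    ≡⟨ cong (λ d → suc a * (n ! * (b C d)) + b * (n ! * (pred b C k))) n∸a≡1+k ⟩
  suc a * (n ! * (b C suc k)) + b * (n ! * (pred b C k))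
    ≡⟨ cong (suc a * (n ! * (b C suc k)) +_) (x∙yz≈y∙xz b (n !) _) ⟩
  suc a * (n ! * (b C suc k)) + n ! * (b * (pred b C k))
    ≡⟨ cong (λ x → suc a * (n ! * (b C suc k)) + n ! * x) (n*[n∸1]Ck≡[k+1]*nC[k+1] b k) ⟩
  suc a * (n ! * (b C suc k)) + n ! * (suc k * (b C suc k))
    ≡⟨ collect a k (n !) (b C suc k) ⟩
  suc (suc a + k) * (n ! * (b C suc k))
    ≡⟨ cong (λ m → suc m * (n ! * (b C suc k))) (m+[n∸m]≡n a<n) ⟩
  suc n * (n ! * (b C suc k))
    ≡⟨ *-assoc (suc n) (n !) _ ⟨
  suc n ! * (b C suc k)
    ≡⟨ cong (λ d → suc n ! * (b C d)) n∸a≡1+k ⟨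
  suc n ! * (b C (n ∸ a)) ∎
  where
  open ≤-Reasoning
  k : ℕ
  k = n ∸ suc a
  n∸a≡1+k : n ∸ a ≡ suc k
  n∸a≡1+k = +-∸-assoc 1 a<n
  collect : ∀ a k x c → suc a * (x * c) + x * (suc k * c) ≡ suc (suc a + k) * (x * c)
  collect = solve-∀

T-∧⁻ : ∀ a {b} → T (a ∧ b) → T a × T b
T-∧⁻ true h = _ , h

T-∨⁻ : ∀ a {b} → T (a ∨ b) → T a ⊎ T b
T-∨⁻ true  _ = inj₁ _
T-∨⁻ false h = inj₂ h

T-not⇒¬T : ∀ {a} → T (not a) → ¬ T a
T-not⇒¬T {false} _ ()

T-ext : ∀ {a b} → (T a → T b) → (T b → T a) → a ≡ b
T-ext {true}  {true}  _   _   = refl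
T-ext {true}  {false} a⇒b _   = contradiction _ a⇒b
T-ext {false} {true}  _   b⇒a = contradiction _ b⇒a
T-ext {false} {false} _   _   = refl

T-⇔ᵇ⁻ : ∀ a {b} → T (a ⇔ᵇ b) → a ≡ b
T-⇔ᵇ⁻ true  {true}  _ = refl
T-⇔ᵇ⁻ false {false} _ = refl

T-allᶠ⁻ : ∀ {k} {p : Fin k → Bool} → T (allᶠ p) → ∀ i → T (p i)
T-allᶠ⁻ {k} {p} h i = All.lookup (all⁺ p (allFin k) h) (∈-allFin i)

T-anyᶠ⁻ : ∀ {k} {p : Fin k → Bool} → T (anyᶠ p) → ∃ λ i → T (p i)
T-anyᶠ⁻ {k} {p} h = Any.satisfied (any⁻ p (allFin k) h)

Vec-ext : ∀ {A : Set} {k} {u u′ : Vec A k} → (∀ i → lookup u i ≡ lookup u′ i) → u ≡ u′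
Vec-ext {u = u} {u′} h = trans (sym (tabulate∘lookup u)) (trans (tabulate-cong h) (tabulate∘lookup u′))

isSubgraph⇒ : ∀ {m} (G : Fin m → Fin m → Bool) {S E} → T (isSubgraph G (S , E)) →
              ∀ {i j} → T (edge E i j) → T (G i j) × T (lookup S i) × T (lookup S j)
isSubgraph⇒ G {S} {E} h {i} {j} ij with T-∨⁻ (not (edge E i j)) (T-allᶠ⁻ (T-allᶠ⁻ h i) j)
... | inj₁ ¬ij       = contradiction ij (T-not⇒¬T ¬ij)
... | inj₂ Gij,Si,Sj with Gij , Si,Sj ← T-∧⁻ (G i j) Gij,Si,Sj = Gij , T-∧⁻ (lookup S i) Si,Sj

module _ {n m : ℕ} (F : Graph n) (G : Fin m → Fin m → Bool) (v : Fin m) where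

  record CopyAt (S : Vec Bool m) (E : Vec (Vec Bool m) m) (σ : Vec (Fin m) n) : Set where
    field
      ∋v        : T (lookup S v)
      edge⇒G    : ∀ {i j} → T (edge E i j) → T (G i j) × T (lookup S i) × T (lookup S j)
      injective : ∀ {a b} → lookup σ a ≡ lookup σ b → a ≡ b
      image     : ∀ i → lookup S i ≡ anyᶠ (λ a → lookup σ a == i)
      adj≡edge  : ∀ a b → adj F a b ≡ edge E (lookup σ a) (lookup σ b)

    preimage : ∀ {i} → T (lookup S i) → ∃ λ a → lookup σ a ≡ i
    preimage {i} i∈S with a , σa==i ← T-anyᶠ⁻ (subst T (image i) i∈S) = a , toWitness σa==i

    adj⇒G : ∀ {a b} → T (adj F a b) → T (G (lookup σ a) (lookup σ b))
    adj⇒G {a} {b} ab = proj₁ (edge⇒G (subst T (adj≡edge a b) ab))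

  isCopyAt⇒CopyAt : ∀ {S E} → T (isCopyAt F G v (S , E)) → ∃ λ σ → CopyAt S E σ
  isCopyAt⇒CopyAt {S} {E} h
    with ∋v , rest ← T-∧⁻ (lookup S v) h
    with subgraph , iso ← T-∧⁻ (isSubgraph G (S , E)) rest
    with σ , σ-iso ← Any.satisfied (any⁻ (isIsoOnto F (S , E)) (allVecs (allFin m) n) iso)
    with injective , rest′ ← T-∧⁻ (allᶠ λ a → allᶠ λ b → (lookup σ a == lookup σ b) ⇔ᵇ (a == b)) σ-iso
    with image , edges ← T-∧⁻ (allᶠ λ i → lookup S i ⇔ᵇ (anyᶠ λ a → lookup σ a == i)) rest′ = σ , record
    { ∋v        = ∋v
    ; edge⇒G    = isSubgraph⇒ G {S} {E} subgraph
    ; injective = λ {a} {b} e →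
        toWitness (subst T (T-⇔ᵇ⁻ (lookup σ a == lookup σ b) (T-allᶠ⁻ (T-allᶠ⁻ injective a) b))
                           (fromWitness e))
    ; image     = λ i → T-⇔ᵇ⁻ (lookup S i) (T-allᶠ⁻ image i)
    ; adj≡edge  = λ a b → T-⇔ᵇ⁻ (adj F a b) (T-allᶠ⁻ (T-allᶠ⁻ edges a) b)
    }

  -- The edges of a copy lie inside its vertex set, so both are determined by σ.
  CopyAt-unique : ∀ {S E S′ E′ σ} → CopyAt S E σ → CopyAt S′ E′ σ → (S , E) ≡ (S′ , E′)
  CopyAt-unique c c′ = cong₂ _,_
    (Vec-ext λ i → trans (image c i) (sym (image c′ i)))
    (Vec-ext λ i → Vec-ext λ j → T-ext (edge-transfer c c′) (edge-transfer c′ c))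
    where
    open CopyAt
    edge-transfer : ∀ {S E S′ E′ σ i j} → CopyAt S E σ → CopyAt S′ E′ σ →
                    T (edge E i j) → T (edge E′ i j)
    edge-transfer c c′ ij
      with _ , Si , Sj ← edge⇒G c ij
      with a , refl ← preimage c Si | b , refl ← preimage c Sj =
      subst T (adj≡edge c′ a b) (subst T (sym (adj≡edge c a b)) ij)

concatMap-map≡cartesianProductWith : ∀ {A B C : Set} (f : A → B → C) xs ys →
                                     concatMap (λ x → map (f x) ys) xs ≡ cartesianProductWith f xs ys
concatMap-map≡cartesianProductWith f []       ys = refl
concatMap-map≡cartesianProductWith f (x ∷ xs) ys =
  cong (map (f x) ys ++_) (concatMap-map≡cartesianProductWith f xs ys)

Unique-allVecs : ∀ {A : Set} {xs : List A} → Unique xs → ∀ k → Unique (allVecs xs k)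
Unique-allVecs           u zero    = All.[] ∷ []
Unique-allVecs {xs = xs} u (suc k) =
  subst Unique (sym (concatMap-map≡cartesianProductWith Vec._∷_ xs (allVecs xs k)))
    (cartesianProductWith⁺ Vec._∷_ (λ { refl → refl , refl }) u (Unique-allVecs u k))

Unique-allSubG : ∀ m → Unique (allSubG m)
Unique-allSubG m =
  subst Unique (sym (concatMap-map≡cartesianProductWith _,_ (allVecs bools m) (allVecs (allVecs bools m) m)))
    (cartesianProductWith⁺ _,_ (λ { refl → refl , refl }) Unique-S (Unique-allVecs Unique-S m))
  where
  Unique-S : Unique (allVecs bools m)
  Unique-S = Unique-allVecs (((λ ()) All.∷ All.[]) ∷ All.[] ∷ []) m

tabulate-injective : ∀ {A : Set} {k} {f g : Fin k → A} →
                     List.tabulate f ≡ List.tabulate g → ∀ i → f i ≡ g i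
tabulate-injective {k = suc k} e Fin.zero    = proj₁ (∷-injective e)
tabulate-injective {k = suc k} e (Fin.suc i) = tabulate-injective (proj₂ (∷-injective e)) i

positions : ∀ {n m} → Vec (Fin m) n → List ℕ
positions σ = List.tabulate (toℕ ∘ lookup σ)

positions-injective : ∀ {n m} {σ σ′ : Vec (Fin m) n} → positions σ ≡ positions σ′ → σ ≡ σ′
positions-injective e = Vec-ext (toℕ-injective ∘ tabulate-injective e)

module _ {n m : ℕ} (F : Graph n) (G : Fin m → Fin m → Bool) (v : Fin m) where

  Fdeg≤ : (ws : List (List ℕ)) → (∀ {S E σ} → CopyAt F G v S E σ → positions σ ∈ ws) →
          Fdeg F G v ≤ length ws
  Fdeg≤ ws positions∈ws =
    injection⇒length≤ Encodes Encodes-injective (filter⁺ (T? ∘ isCopyAt F G v) (Unique-allSubG m)) ws encode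
    where
    Encodes : SubG m → List ℕ → Set
    Encodes (S , E) w = ∃ λ σ → CopyAt F G v S E σ × w ≡ positions σ

    Encodes-injective : ∀ {H H′ w} → Encodes H w → Encodes H′ w → H ≡ H′
    Encodes-injective {_ , _} {_ , _} (σ , c , refl) (σ′ , c′ , e)
      with refl ← positions-injective {σ = σ} {σ′} e = CopyAt-unique F G v c c′

    encode : ∀ {H} → H ∈ filterᵇ (isCopyAt F G v) (allSubG m) → ∃ λ w → w ∈ ws × Encodes H w
    encode {S , E} H∈
      with _ , copy ← ∈-filter⁻ (T? ∘ isCopyAt F G v) {xs = allSubG m} H∈
      with σ , c ← isCopyAt⇒CopyAt F G v copy = positions σ , positions∈ws c , σ , c , refl

module _ (l t : ℕ) {x y : Fin (2 * l)} where

  private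
    i j M : ℕ
    i = toℕ x
    j = toℕ y
    M = 2 * l ∸ 1

  FL-adj⇒ : T (FL-adj l t x y) → (i < M × ∣ i - j ∣ ≤ l ∸ 1) ⊎ (j ≡ M × i < t) ⊎ (i ≡ M × j < t)
  FL-adj⇒ h with T-∨⁻ (not (i ≡ᵇ j) ∧ (i <ᵇ M) ∧ (j <ᵇ M) ∧ (∣ i - j ∣ ≤ᵇ l ∸ 1)) h
  ... | inj₁ path
    with _ , path′ ← T-∧⁻ (not (i ≡ᵇ j)) path
    with i<M , path″ ← T-∧⁻ (i <ᵇ M) path′
    with _ , close ← T-∧⁻ (j <ᵇ M) path″ = inj₁ (<ᵇ⇒< i M i<M , ≤ᵇ⇒≤ ∣ i - j ∣ (l ∸ 1) close)
  ... | inj₂ spoke with T-∨⁻ ((j ≡ᵇ M) ∧ (i <ᵇ t)) spoke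
  ...   | inj₁ in-spoke  with j≡M , i<t ← T-∧⁻ (j ≡ᵇ M) in-spoke  =
    inj₂ (inj₁ (≡ᵇ⇒≡ j M j≡M , <ᵇ⇒< i t i<t))
  ...   | inj₂ out-spoke with i≡M , j<t ← T-∧⁻ (i ≡ᵇ M) out-spoke =
    inj₂ (inj₂ (≡ᵇ⇒≡ i M i≡M , <ᵇ⇒< j t j<t))

  FL-adj-last : t < M → i ≡ M → T (FL-adj l t x y) → j < t
  FL-adj-last t<M i≡M h with FL-adj⇒ h
  ... | inj₁ (i<M , _)        = contradiction i≡M (<⇒≢ i<M)
  ... | inj₂ (inj₁ (_ , i<t)) = contradiction i≡M (<⇒≢ (<-trans i<t t<M))
  ... | inj₂ (inj₂ (_ , j<t)) = j<t

  FL-adj-low : t < M → i < t → T (FL-adj l t x y) → j ≡ M ⊎ j < t + (l ∸ 1)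
  FL-adj-low t<M i<t h with FL-adj⇒ h
  ... | inj₁ (_ , close)       = inj₂ (≤-<-trans (m≤n+∣n-m∣ j i) (+-mono-<-≤ i<t close))
  ... | inj₂ (inj₁ (j≡M , _))  = inj₁ j≡M
  ... | inj₂ (inj₂ (i≡M , _))  = contradiction i≡M (<⇒≢ (<-trans i<t t<M))

2*l∸1≡l+[l∸1] : ∀ l → 2 * l ∸ 1 ≡ l + (l ∸ 1)
2*l∸1≡l+[l∸1] zero    = refl
2*l∸1≡l+[l∸1] (suc l) = trans (cong (l +_) (cong suc (+-identityʳ l))) (+-suc l l)

module CopiesThroughLast {n l t : ℕ} (F : Graph n)
  (within-2 : ∀ a b → a ≢ b → T (adj F a b) ⊎ ∃ λ c → T (adj F a c ∧ adj F c b))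
  (t≤deg : ∀ a → t ≤ deg F a) (t<l : t < l) {v : Fin (2 * l)} (v-last : toℕ v ≡ 2 * l ∸ 1) where

  last : ℕ
  last = 2 * l ∸ 1

  required optional : List ℕ
  required = last ∷ upTo t
  optional = applyUpTo (t +_) (l ∸ 1)

  t+[l∸1]≤last : t + (l ∸ 1) ≤ last
  t+[l∸1]≤last = ≤-trans (+-monoˡ-≤ (l ∸ 1) (<⇒≤ t<l)) (≤-reflexive (sym (2*l∸1≡l+[l∸1] l)))

  t<last : t < last
  t<last = <-≤-trans t<l (≤-trans (m≤m+n l (l ∸ 1)) (≤-reflexive (sym (2*l∸1≡l+[l∸1] l))))

  ∈-optional⁻ : ∀ {y} → y ∈ optional → t ≤ y × y < t + (l ∸ 1)
  ∈-optional⁻ y∈ with k , k<l∸1 , refl ← ∈-applyUpTo⁻ (t +_) y∈ = m≤m+n t k , +-monoʳ-< t k<l∸1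

  classify : ∀ {y} → y ≡ last ⊎ y < t + (l ∸ 1) → y ∈ required ⊎ y ∈ optional
  classify (inj₁ y≡last) = inj₁ (here y≡last)
  classify {y} (inj₂ y<t+l∸1) with y <? t
  ... | yes y<t = inj₁ (there (∈-upTo⁺ y<t))
  ... | no  y≮t = inj₂ (subst (_∈ optional) (m+[n∸m]≡n t≤y) (∈-applyUpTo⁺ (t +_) y∸t<l∸1))
    where
    t≤y : t ≤ y
    t≤y = ≮⇒≥ y≮t
    y∸t<l∸1 : y ∸ t < l ∸ 1
    y∸t<l∸1 = subst (y ∸ t <_) (m+n∸m≡n t (l ∸ 1)) (∸-monoˡ-< y<t+l∸1 t≤y)

  Unique-required : Unique required
  Unique-required =
    All.tabulate (λ r∈ last≡r → <⇒≢ (<-trans (∈-upTo⁻ r∈) t<last) (sym last≡r)) ∷ upTo⁺ t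

  required#optional : Disjoint required optional
  required#optional (here refl , y∈) = <⇒≢ (<-≤-trans (proj₂ (∈-optional⁻ y∈)) t+[l∸1]≤last) refl
  required#optional (there y<t , y∈) = <⇒≱ (∈-upTo⁻ y<t) (proj₁ (∈-optional⁻ y∈))

  module _ {S E σ} (c : CopyAt F (FL-adj l t) v S E σ) where

    open CopyAt c

    position : Fin n → ℕ
    position = toℕ ∘ lookup σ

    position-injective : ∀ {a b} → position a ≡ position b → a ≡ b
    position-injective = injective ∘ toℕ-injective

    centre : Fin n
    centre = proj₁ (preimage ∋v)

    centre-last : position centre ≡ last
    centre-last = trans (cong toℕ (proj₂ (preimage ∋v))) v-last

    neighbour-low : ∀ {b} → T (adj F centre b) → position b < t
    neighbour-low ab = FL-adj-last l t t<last centre-last (adj⇒G ab)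

    positions-within : ∀ {y} → y ∈ positions σ → y ∈ required ⊎ y ∈ optional
    positions-within y∈
      with b , refl ← ∈-tabulate⁻ y∈
      with b ≟ᶠ centre
    ... | yes refl = inj₁ (here centre-last)
    ... | no  b≢centre with within-2 centre b (b≢centre ∘ sym)
    ...   | inj₁ adjacent = classify (inj₂ (<-≤-trans (neighbour-low adjacent) (m≤m+n t (l ∸ 1))))
    ...   | inj₂ (d , path) with cd , db ← T-∧⁻ (adj F centre d) path =
      classify (FL-adj-low l t t<last (neighbour-low cd) (adj⇒G db))

    -- σ maps the at least t neighbours of the centre injectively into the t low vertices.
    onto-low : ∀ {r} → r < t → ∃ λ b → position b ≡ r
    onto-low r<t = injection-onto _≟_ position position-injective
      (filter⁺ (T? ∘ adj F centre) (allFin⁺ n))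
      (λ b∈ → ∈-upTo⁺ (neighbour-low (proj₂ (∈-filter⁻ (T? ∘ adj F centre) {xs = allFin n} b∈))))
      (≤-trans (≤-reflexive (length-upTo t)) (t≤deg centre))
      (∈-upTo⁺ r<t)

    required⊆positions : required ⊆ positions σ
    required⊆positions (here refl) = subst (_∈ positions σ) centre-last (∈-tabulate⁺ centre)
    required⊆positions (there r<t) with b , refl ← onto-low (∈-upTo⁻ r<t) = ∈-tabulate⁺ b

    positions∈arrangements : positions σ ∈ arrangements n required optional
    positions∈arrangements =
      subst (λ k → positions σ ∈ arrangements k required optional) (length-tabulate position)
        (∈-arrangements Unique-required required#optional (tabulate⁺ position-injective)
                        required⊆positions positions-within)

deg≤order : ∀ {n} (F : Graph n) a → deg F a ≤ n
deg≤order {n} F a = ≤-trans (length-filter (T? ∘ adj F a) (allFin n)) (≤-reflexive (length-tabulate id))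

lemma6 : ∀ {n} (F : Graph n) (t l : ℕ) → HasDiameter2 F → IsMinDegree F t → n < l →
           (v : Fin (2 * l)) → toℕ v ≡ 2 * l ∸ 1 →
           Fdeg F (FL-adj l t) v ≤ (n !) * ((l ∸ 1) C (n ∸ t ∸ 1))
lemma6 {n} F t l (within-2 , _) (t≤deg , a , deg≡t) n<l v v-last = begin
  Fdeg F (FL-adj l t) v                     ≤⟨ Fdeg≤ F (FL-adj l t) v _ positions∈arrangements ⟩
  length (arrangements n required optional) ≡⟨ length-arrangements n required optional ⟩
  #arrangements n (suc (length (upTo t))) (length optional)
    ≡⟨ cong₂ (λ a b → #arrangements n (suc a) b) (length-upTo t) (length-applyUpTo (t +_) (l ∸ 1)) ⟩
  #arrangements n (suc t) (l ∸ 1)           ≤⟨ #arrangements≤ n (suc t) (l ∸ 1) ⟩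
  n ! * ((l ∸ 1) C (n ∸ suc t))             ≡⟨ cong (λ k → n ! * ((l ∸ 1) C k)) n∸[1+t]≡n∸t∸1 ⟩
  n ! * ((l ∸ 1) C (n ∸ t ∸ 1))             ∎
  where
  open ≤-Reasoning
  t<l : t < l
  t<l = ≤-<-trans (subst (_≤ n) deg≡t (deg≤order F a)) n<l
  open CopiesThroughLast F within-2 t≤deg t<l v-last
  n∸[1+t]≡n∸t∸1 : n ∸ suc t ≡ n ∸ t ∸ 1
  n∸[1+t]≡n∸t∸1 = trans (cong (n ∸_) (+-comm 1 t)) (sym (∸-+-assoc n t 1))
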